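{- Let $t$ be a closed term. If $\Phi$ is a derivation in the CbNeed type system of $\vdash^{(m,e)} t : M$ (empty type context), then there is a term $s$ and an evaluation sequence $d \colon t \to_{\mathrm{need}}^{*} s$ such that $\mathrm{normal}(s)$, $|d|_{m} \leq m$ and $|d|_{e} \leq e$. Moreover, if $\Phi$ is tight then $|d|_{m} = m$ and $|d|_{e} = e$.
   Context: Terms: $t,s ::= x \mid \lambda x.t \mid t\,s \mid t[x\leftarrow s]$, where $t[x\leftarrow s]$ (explicit substitution) binds $x$ in $t$; values $v ::= \lambda x.t$. $\mathrm{fv}(t[x\leftarrow s])=(\mathrm{fv}(t)\setminus\{x\})\cup\mathrm{fv}(s)$; $t$ is closed if $\mathrm{fv}(t)=\emptyset$; terms are up to $\alpha$-equivalence. Contexts (one hole $\langle\cdot\rangle$): substitution contexts $S ::= \langle\cdot\rangle \mid S[x\leftarrow t]$; CbNeed contexts $E ::= \langle\cdot\rangle \mid E\,t \mid E[x\leftarrow t] \mid E\langle\langle x\rangle\rangle[x\leftarrow E']$. $E\langle t\rangle$ is plugging (may capture); $E\langle\langle t\rangle\rangle$ denotes plugging where $E$ does not capture free variables of $t$. Root steps: $S\langle\lambda x.t\rangle s \mapsto_m S\langle t[x\leftarrow s]\rangle$ (variables bound by $S$ disjoint from $\mathrm{fv}(s)$); $E\langle\langle x\rangle\rangle[x\leftarrow S\langle v\rangle] \mapsto_{e} S\langle E\langle\langle v\rangle\rangle[x\leftarrow v]\rangle$ (variables bound by $S$ disjoint from $\mathrm{fv}(E\langle\langle x\rangle\rangle)$).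 $\to_{m,\mathrm{need}}$ (resp. $\to_{e,\mathrm{need}}$) relates $E\langle t'\rangle$ to $E\langle s'\rangle$ for any CbNeed context $E$ whenever $t'\mapsto_m s'$ (resp. $t'\mapsto_e s'$); $\to_{\mathrm{need}}=\to_{m,\mathrm{need}}\cup\to_{e,\mathrm{need}}$. For an evaluation sequence $d$, $|d|_m$, $|d|_e$ are its numbers of multiplicative and exponential steps. $\mathrm{normal}$ is the least predicate with $\mathrm{normal}(\lambda x.t)$ and $\mathrm{normal}(t)\Rightarrow\mathrm{normal}(t[x\leftarrow s])$. CbNeed types: linear types $L ::= \mathsf{normal} \mid M \to N$; multi types $M,N ::= [L_i]_{i\in J}$ finite multisets ($J$ finite), $\mathbf{0}$ the empty multiset, $\uplus$ multiset union. A type context $\Gamma$ maps variables to multi types, all but finitely many to $\mathbf 0$; $\mathrm{dom}(\Gamma)=\{x\mid\Gamma(x)\neq\mathbf 0\}$; $\Gamma$ is empty if its domain is empty; $\uplus$ extends pointwise; $\Gamma, x:M$ means $\Gamma\uplus(x\mapsto M)$ with $x\notin\mathrm{dom}(\Gamma)$. Judgements $\Gamma\vdash^{(m,e)} t : T$, $m,e\in\mathbb N$. Rules: (ax) $x:M \vdash^{(0,1)} x : M$ (with $M\neq\mathbf 0$, axioms not introducing $\mathbf 0$); (normal) $\vdash^{(0,0)} \lambda x.t : \mathsf{normal}$; (fun) from $\Gamma, x:M \vdash^{(m,e)} t : N$ infer $\Gamma\vdash^{(m,e)} \lambda x.t : M\to N$; (many) from $\Gamma_i\vdash^{(m_i,e_i)}\lambda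 x.t : L_i$ for $i\in J$, $J\neq\emptyset$, infer $\biguplus_i\Gamma_i\vdash^{(\sum m_i,\sum e_i)}\lambda x.t : [L_i]_{i\in J}$; (app$_{gc}$) from $\Gamma\vdash^{(m,e)} t:[\mathbf 0\to M]$ infer $\Gamma\vdash^{(m+1,e)} t\,s : M$; (app) from $\Gamma\vdash^{(m,e)} t : [N\to M]$ and $\Pi\vdash^{(m',e')} s:N$ with $N\neq\mathbf 0$ infer $\Gamma\uplus\Pi\vdash^{(m+m'+1,e+e')} t\,s:M$; (ES$_{gc}$) from $\Gamma\vdash^{(m,e)} t:M$ with $\Gamma(x)=\mathbf 0$ infer $\Gamma\vdash^{(m,e)} t[x\leftarrow s]:M$; (ES) from $\Gamma,x:N\vdash^{(m,e)} t:M$ and $\Pi\vdash^{(m',e')} s:N$ with $N\neq\mathbf 0$ infer $\Gamma\uplus\Pi\vdash^{(m+m',e+e')} t[x\leftarrow s]:M$. A derivation of $\Gamma\vdash^{(m,e)} t:M$ is tight if $M=[\mathsf{normal}]$ and $\Gamma$ is empty. -}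

module Defs where

open import Data.Nat using (ℕ; zero; suc; _+_)
open import Data.Fin using (Fin; zero; suc)
open import Data.List using (List; []; _∷_)
open import Data.List.Relation.Binary.Permutation.Homogeneous using (Permutation)
open import Data.Vec using (Vec; []; _∷_; zipWith; replicate; _[_]≔_)
open import Data.Product using (_×_)
open import Relation.Binary.PropositionalEquality using (_≡_; _≢_)
open import Function using (id; _∘_)

-- Terms, well-scoped de Bruijn (terms up to α-equivalence).
-- Tm n = terms whose free variables are among n variables;
-- closed terms are Tm 0.  es t s = t[x←s], x = index zero of t.

data Tm (n : ℕ) : Set where
  var : Fin n → Tm n
  lam : Tm (suc n) → Tm n
  app : Tm n → Tm n → Tm n
  es  : Tm (suc n) → Tm n → Tm n

lift : ∀ {n m} → (Fin n → Fin m) → Fin (suc n) → Fin (suc m)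
lift ρ zero    = zero
lift ρ (suc i) = suc (ρ i)

ren : ∀ {n m} → (Fin n → Fin m) → Tm n → Tm m
ren ρ (var x)  = var (ρ x)
ren ρ (lam t)  = lam (ren (lift ρ) t)
ren ρ (app t s) = app (ren ρ t) (ren ρ s)
ren ρ (es t s) = es (ren (lift ρ) t) (ren ρ s)

-- Substitution contexts  S ::= ⟨·⟩ | S[x←t]
-- (an SCtx n lives in scope n; its hole lives in scope hsS S)

data SCtx : ℕ → Set where
  hole : ∀ {n} → SCtx n
  sES  : ∀ {n} → SCtx (suc n) → Tm n → SCtx n

hsS : ∀ {n} → SCtx n → ℕ
hsS {n} hole  = n
hsS (sES S t) = hsS S

-- the weakening of the outer scope into the hole scope (S captures nothing
-- from outside)
sWk : ∀ {n} (S : SCtx n) → Fin n → Fin (hsS S)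
sWk hole      = id
sWk (sES S t) = sWk S ∘ suc

-- capturing plugging S⟨u⟩
plugS : ∀ {n} (S : SCtx n) → Tm (hsS S) → Tm n
plugS hole      u = u
plugS (sES S t) u = es (plugS S u) t

-- CbNeed contexts  E ::= ⟨·⟩ | E t | E[x←t] | E⟨⟨x⟩⟩[x←E']

data ECtx : ℕ → Set where
  hole : ∀ {n} → ECtx n
  appL : ∀ {n} → ECtx n → Tm n → ECtx n
  esL  : ∀ {n} → ECtx (suc n) → Tm n → ECtx n
  esR  : ∀ {n} → ECtx (suc n) → ECtx n → ECtx n      -- E⟨⟨x⟩⟩[x←E']

hs : ∀ {n} → ECtx n → ℕ
hs {n} hole  = n
hs (appL E t) = hs E
hs (esL E t)  = hs E
hs (esR E E') = hs E'

eWk : ∀ {n} (E : ECtx n) → Fin n → Fin (hs E)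
eWk hole       = id
eWk (appL E t) = eWk E
eWk (esL E t)  = eWk E ∘ suc
eWk (esR E E') = eWk E'

-- capturing plugging E⟨u⟩
plugE : ∀ {n} (E : ECtx n) → Tm (hs E) → Tm n
plugE hole       u = u
plugE (appL E t) u = app (plugE E u) t
plugE (esL E t)  u = es (plugE E u) t
plugE (esR E E') u = es (plugE E (var (eWk E zero))) (plugE E' u)

-- non-capturing plugging E⟨⟨u⟩⟩
plugE⟪_⟫ : ∀ {n} (E : ECtx n) → Tm n → Tm n
plugE⟪ E ⟫ u = plugE E (ren (eWk E) u)

renE : ∀ {n m} → (Fin n → Fin m) → ECtx n → ECtx m
renE ρ hole       = hole
renE ρ (appL E t) = appL (renE ρ E) (ren ρ t)
renE ρ (esL E t)  = esL (renE (lift ρ) E) (ren ρ t)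
renE ρ (esR E E') = esR (renE (lift ρ) E) (renE ρ E')

-- S⟨λx.t⟩ s ↦m S⟨t[x←s]⟩   (s is weakened under the binders of S)
data RootM {n : ℕ} : Tm n → Tm n → Set where
  ↦m : (S : SCtx n) (t : Tm (suc (hsS S))) (s : Tm n) →
       RootM (app (plugS S (lam t)) s) (plugS S (es t (ren (sWk S) s)))

-- E⟨⟨x⟩⟩[x←S⟨v⟩] ↦e S⟨E⟨⟨v⟩⟩[x←v]⟩
-- (E⟨⟨x⟩⟩ is weakened under the binders of S when moved inside S)
data RootE {n : ℕ} : Tm n → Tm n → Set where
  ↦e : (E : ECtx (suc n)) (S : SCtx n) (b : Tm (suc (hsS S))) →
       RootE (es (plugE⟪ E ⟫ (var zero)) (plugS S (lam b)))
             (plugS S (es (plugE⟪ renE (lift (sWk S)) E ⟫ (ren suc (lam b))) (lam b)))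

data Kind : Set where
  mul expo : Kind

Root : ∀ {n} → Kind → Tm n → Tm n → Set
Root mul  = RootM
Root expo = RootE

data Step {n : ℕ} (k : Kind) : Tm n → Tm n → Set where
  ctx : (E : ECtx n) {t u : Tm (hs E)} → Root k t u → Step k (plugE E t) (plugE E u)

data _⇒*_ {n : ℕ} : Tm n → Tm n → Set where
  ε   : ∀ {t} → t ⇒* t
  _◅_ : ∀ {k t u s} → Step k t u → u ⇒* s → t ⇒* s

infixr 5 _◅_

∣_∣m : ∀ {n} {t s : Tm n} → t ⇒* s → ℕ
∣ ε ∣m = 0
∣ _◅_ {mul}  _ d ∣m = suc ∣ d ∣m
∣ _◅_ {expo} _ d ∣m = ∣ d ∣m

∣_∣e : ∀ {n} {t s : Tm n} → t ⇒* s → ℕ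
∣ ε ∣e = 0
∣ _◅_ {mul}  _ d ∣e = ∣ d ∣e
∣ _◅_ {expo} _ d ∣e = suc ∣ d ∣e

data Normal {n : ℕ} : Tm n → Set where
  nlam : ∀ {t} → Normal (lam t)
  nes  : ∀ {t s} → Normal t → Normal (es t s)

-- CbNeed types.  Multisets are represented by lists; equality of
-- multisets is list permutation up to (recursive) type equivalence _≅L_.

data Lin : Set where
  normal : Lin
  _⟶_   : List Lin → List Lin → Lin

Multi : Set
Multi = List Lin

mutual
  data _≅L_ : Lin → Lin → Set where
    normal : normal ≅L normal
    arr    : ∀ {M M' N N'} → M ≅M M' → N ≅M N' → (M ⟶ N) ≅L (M' ⟶ N')

  _≅M_ : Multi → Multi → Set
  _≅M_ = Permutation _≅L_

TyCtx : ℕ → Set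
TyCtx n = Vec Multi n

∅ : ∀ {n} → TyCtx n
∅ = replicate _ []

_⊎_ : ∀ {n} → TyCtx n → TyCtx n → TyCtx n
_⊎_ = zipWith Data.List._++_

single : ∀ {n} → Fin n → Multi → TyCtx n
single x M = ∅ [ x ]≔ M

IsEmpty : ∀ {n} → TyCtx n → Set
IsEmpty Γ = Γ ≡ ∅

mutual
  data _⊢ℓ[_,_]_∶_ {n : ℕ} : TyCtx n → ℕ → ℕ → Tm n → Lin → Set where
    normal : ∀ {t} → ∅ ⊢ℓ[ 0 , 0 ] lam t ∶ normal
    fun    : ∀ {Γ m e t M N} → (M ∷ Γ) ⊢[ m , e ] t ∶ N →
             Γ ⊢ℓ[ m , e ] lam t ∶ (M ⟶ N)

  data _⊢ℓs[_,_]_∶_ {n : ℕ} : TyCtx n → ℕ → ℕ → Tm n → List Lin → Set where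
    []  : ∀ {t} → ∅ ⊢ℓs[ 0 , 0 ] t ∶ []
    _∷_ : ∀ {Γ Π m e m' e' t L Ls} → Γ ⊢ℓ[ m , e ] t ∶ L → Π ⊢ℓs[ m' , e' ] t ∶ Ls →
          (Γ ⊎ Π) ⊢ℓs[ m + m' , e + e' ] t ∶ (L ∷ Ls)

  data _⊢[_,_]_∶_ {n : ℕ} : TyCtx n → ℕ → ℕ → Tm n → Multi → Set where
    ax    : ∀ {x M} → M ≢ [] → single x M ⊢[ 0 , 1 ] var x ∶ M
    many  : ∀ {Γ m e t Ls} → Ls ≢ [] → Γ ⊢ℓs[ m , e ] lam t ∶ Ls →
            Γ ⊢[ m , e ] lam t ∶ Ls
    appgc : ∀ {Γ m e t s M} → Γ ⊢[ m , e ] t ∶ (([] ⟶ M) ∷ []) →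
            Γ ⊢[ m + 1 , e ] app t s ∶ M
    app   : ∀ {Γ Π m e m' e' t s M N N'} →
            Γ ⊢[ m , e ] t ∶ ((N ⟶ M) ∷ []) → Π ⊢[ m' , e' ] s ∶ N' →
            N ≢ [] → N ≅M N' →
            (Γ ⊎ Π) ⊢[ m + m' + 1 , e + e' ] app t s ∶ M
    esgc  : ∀ {Γ m e t s M} → ([] ∷ Γ) ⊢[ m , e ] t ∶ M →
            Γ ⊢[ m , e ] es t s ∶ M
    es    : ∀ {Γ Π m e m' e' t s M N N'} →
            (N ∷ Γ) ⊢[ m , e ] t ∶ M → Π ⊢[ m' , e' ] s ∶ N' →
            N ≢ [] → N ≅M N' →
            (Γ ⊎ Π) ⊢[ m + m' , e + e' ] es t s ∶ M

Tight : ∀ {n} {Γ : TyCtx n} {m e t M} → Γ ⊢[ m , e ] t ∶ M → Set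
Tight {Γ = Γ} {M = M} _ = (M ≡ normal ∷ []) × IsEmpty Γ

module Submission where

-- The proof is quantitative subject reduction plus progress.  Since types
-- are multisets (lists up to permutation) and contexts are added with ⊎,
-- we first work in a type system "up to equivalence" (_⊩[_,_]_∶_), in which
-- every rule absorbs equivalence of contexts and types; CbNeed derivations
-- embed into it with the same counters.  From these, each root step preserves typing while
-- consuming exactly one multiplicative or exponential step (subject-m,
-- subject-m-gc, subject-e), and every typed term is normal, stuck on a free
-- variable, or steps (progress).  For closed terms the counters strictly
-- decrease, so evaluation terminates (evaluate), and tight derivations of
-- normal forms have null counters (tight-normal), giving the exact bound.

open import Defs
open import Algebra.Bundles using (CommutativeMonoid)
open import Algebra.Structures using (IsCommutativeMonoid)
import Algebra.Properties.CommutativeSemigroup as CommSemigroupProps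
open import Data.Empty using (⊥-elim)
open import Data.Fin using (Fin; zero; suc)
open import Data.List using (List; []; _∷_; _++_)
import Data.List.Properties as List
open import Data.List.Relation.Binary.Pointwise.Base using (Pointwise; []; _∷_)
import Data.List.Relation.Binary.Permutation.Homogeneous as Perm
import Data.List.Relation.Binary.Permutation.Setoid.Properties as PermProps
open import Data.List.Relation.Unary.All as All using ([]; _∷_)
open import Data.Nat using (ℕ; suc; _+_; _≤_)
open import Data.Nat.Properties using (+-comm; +-assoc; +-suc; +-identityʳ; m≤m+n; +-commutativeSemigroup)
open import Data.Product using (Σ; _×_; _,_)
open import Data.Vec using ([]; _∷_)
import Data.Vec.Relation.Binary.Pointwise.Inductive as VecPW
open VecPW using ([]; _∷_)
open import Function using (id; _∘_)
open import Relation.Binary.Bundles using (Setoid)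
open import Relation.Binary.Structures using (IsEquivalence)
open import Relation.Binary.PropositionalEquality
  using (_≡_; _≢_; _≗_; refl; sym; trans; cong; cong₂; subst)

open CommSemigroupProps +-commutativeSemigroup using (xy∙z≈xz∙y; x∙yz≈y∙xz; xy∙z≈x∙zy)

mutual
  ≅L-refl : ∀ {L} → L ≅L L
  ≅L-refl {normal} = normal
  ≅L-refl {M ⟶ N}  = arr ≅M-refl ≅M-refl

  ≅M-refl : ∀ {M} → M ≅M M
  ≅M-refl = Perm.refl ≋-refl

  ≋-refl : ∀ {M} → Pointwise _≅L_ M M
  ≋-refl {[]}    = []
  ≋-refl {L ∷ M} = ≅L-refl ∷ ≋-refl

mutual
  ≅L-sym : ∀ {L L'} → L ≅L L' → L' ≅L L
  ≅L-sym normal    = normal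
  ≅L-sym (arr p q) = arr (≅M-sym p) (≅M-sym q)

  ≅M-sym : ∀ {M M'} → M ≅M M' → M' ≅M M
  ≅M-sym (Perm.refl p)       = Perm.refl (≋-sym p)
  ≅M-sym (Perm.prep p q)     = Perm.prep (≅L-sym p) (≅M-sym q)
  ≅M-sym (Perm.swap p p' q)  = Perm.swap (≅L-sym p') (≅L-sym p) (≅M-sym q)
  ≅M-sym (Perm.trans p q)    = Perm.trans (≅M-sym q) (≅M-sym p)

  ≋-sym : ∀ {M M'} → Pointwise _≅L_ M M' → Pointwise _≅L_ M' M
  ≋-sym []      = []
  ≋-sym (p ∷ q) = ≅L-sym p ∷ ≋-sym q

≅L-trans : ∀ {L L' L''} → L ≅L L' → L' ≅L L'' → L ≅L L''
≅L-trans normal    normal      = normal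
≅L-trans (arr p q) (arr p' q') = arr (Perm.trans p p') (Perm.trans q q')

≅M-trans : ∀ {M M' M''} → M ≅M M' → M' ≅M M'' → M ≅M M''
≅M-trans = Perm.trans

≅M-isEquivalence : IsEquivalence _≅M_
≅M-isEquivalence = record { refl = ≅M-refl ; sym = ≅M-sym ; trans = ≅M-trans }

-- Linear types form a setoid, so multi types are the permutations over it
-- and the library's theory of permutations applies to them.
Lin-setoid : Setoid _ _
Lin-setoid = record
  { Carrier = Lin ; _≈_ = _≅L_
  ; isEquivalence = record { refl = ≅L-refl ; sym = ≅L-sym ; trans = ≅L-trans } }

module Multiset = PermProps Lin-setoid

-- Equivalent multi types have the same size; in particular only 0 is
-- equivalent to 0, and non-emptiness is invariant.
≅0⇒≡0 : ∀ {M} → M ≅M [] → M ≡ []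
≅0⇒≡0 {[]}    _ = refl
≅0⇒≡0 {_ ∷ _} p with Multiset.xs↭ys⇒|xs|≡|ys| p
... | ()

nonempty-resp : ∀ {M M'} → M ≅M M' → M ≢ [] → M' ≢ []
nonempty-resp p M≢0 refl = M≢0 (≅0⇒≡0 p)

singleton-inv : ∀ {L L'} → (L ∷ []) ≅M (L' ∷ []) → L ≅L L'
singleton-inv {L' = L'} p = All.head (Multiset.All-resp-↭ resp (≅M-sym p) (≅L-refl ∷ []))
  where
    resp : ∀ {L₁ L₂} → L₁ ≅L L₂ → L₁ ≅L L' → L₂ ≅L L'
    resp q r = ≅L-trans (≅L-sym q) r

infix 4 _≈_
_≈_ : ∀ {n} → TyCtx n → TyCtx n → Set
_≈_ = VecPW.Pointwise _≅M_

ctx-isCommutativeMonoid : ∀ n → IsCommutativeMonoid (_≈_ {n}) _⊎_ ∅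
ctx-isCommutativeMonoid n = record
  { isMonoid = record
    { isSemigroup = record
      { isMagma = record
        { isEquivalence = VecPW.isEquivalence ≅M-isEquivalence n
        ; ∙-cong = VecPW.zipWith-cong Multiset.++⁺ }
      ; assoc = VecPW.zipWith-assoc Multiset.++-assoc }
    ; identity = VecPW.zipWith-identityˡ Multiset.++-identityˡ
               , VecPW.zipWith-identityʳ Multiset.++-identityʳ }
  ; comm = VecPW.zipWith-comm Multiset.++-comm }

ctx-commutativeMonoid : ℕ → CommutativeMonoid _ _
ctx-commutativeMonoid n = record { isCommutativeMonoid = ctx-isCommutativeMonoid n }

module Ctx {n : ℕ} where
  open CommutativeMonoid (ctx-commutativeMonoid n) public
    using (refl; sym; trans; reflexive; ∙-cong; ∙-congˡ; ∙-congʳ; assoc; comm; identityˡ; identityʳ)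
  open CommSemigroupProps (CommutativeMonoid.commutativeSemigroup (ctx-commutativeMonoid n)) public
    using (xy∙z≈xz∙y; x∙yz≈y∙xz; xy∙z≈x∙zy)

single-cong : ∀ {n} (x : Fin n) {M M'} → M ≅M M' → single x M ≈ single x M'
single-cong zero    p = p ∷ Ctx.refl
single-cong (suc x) p = ≅M-refl ∷ single-cong x p

-- Each rule of the CbNeed system is
-- stated with its context and its types only determined up to ≈ and ≅M.
-- This makes derivations invariant under equivalence (conv below) while
-- keeping inversion on the shape of the term a matter of pattern matching.
mutual
  data _⊩ℓ[_,_]_∶_ {n : ℕ} (Γ : TyCtx n) : ℕ → ℕ → Tm n → Lin → Set where
    normal~ : ∀ {t} → Γ ≈ ∅ → Γ ⊩ℓ[ 0 , 0 ] lam t ∶ normal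
    fun~    : ∀ {Γ₀ m e t M N L} → (M ∷ Γ₀) ⊩[ m , e ] t ∶ N → Γ ≈ Γ₀ → L ≅L (M ⟶ N) →
              Γ ⊩ℓ[ m , e ] lam t ∶ L

  data _⊩ℓs[_,_]_∶_ {n : ℕ} (Γ : TyCtx n) : ℕ → ℕ → Tm n → List Lin → Set where
    nil~  : ∀ {t} → Γ ≈ ∅ → Γ ⊩ℓs[ 0 , 0 ] t ∶ []
    cons~ : ∀ {Γ₁ Γ₂ m e m' e' t L Ls} →
            Γ₁ ⊩ℓ[ m , e ] t ∶ L → Γ₂ ⊩ℓs[ m' , e' ] t ∶ Ls → Γ ≈ Γ₁ ⊎ Γ₂ →
            Γ ⊩ℓs[ m + m' , e + e' ] t ∶ (L ∷ Ls)

  data _⊩[_,_]_∶_ {n : ℕ} (Γ : TyCtx n) : ℕ → ℕ → Tm n → Multi → Set where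
    ax~    : ∀ {x M} → M ≢ [] → Γ ≈ single x M → Γ ⊩[ 0 , 1 ] var x ∶ M
    many~  : ∀ {m e t Ls M} → Γ ⊩ℓs[ m , e ] lam t ∶ Ls → Ls ≅M M → M ≢ [] →
             Γ ⊩[ m , e ] lam t ∶ M
    appgc~ : ∀ {Γ₀ m e t s M₀ M} → Γ₀ ⊩[ m , e ] t ∶ (([] ⟶ M₀) ∷ []) → Γ ≈ Γ₀ → M₀ ≅M M →
             Γ ⊩[ suc m , e ] app t s ∶ M
    app~   : ∀ {Γ₁ Γ₂ m e m' e' t s M₀ M N N'} →
             Γ₁ ⊩[ m , e ] t ∶ ((N ⟶ M₀) ∷ []) → Γ₂ ⊩[ m' , e' ] s ∶ N' → N ≢ [] → N ≅M N' →
             Γ ≈ Γ₁ ⊎ Γ₂ → M₀ ≅M M → Γ ⊩[ suc (m + m') , e + e' ] app t s ∶ M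
    esgc~  : ∀ {Γ₀ m e t s M₀ M} → ([] ∷ Γ₀) ⊩[ m , e ] t ∶ M₀ → Γ ≈ Γ₀ → M₀ ≅M M →
             Γ ⊩[ m , e ] es t s ∶ M
    es~    : ∀ {Γ₁ Γ₂ m e m' e' t s M₀ M N N'} →
             (N ∷ Γ₁) ⊩[ m , e ] t ∶ M₀ → Γ₂ ⊩[ m' , e' ] s ∶ N' → N ≢ [] → N ≅M N' →
             Γ ≈ Γ₁ ⊎ Γ₂ → M₀ ≅M M → Γ ⊩[ m + m' , e + e' ] es t s ∶ M

conv : ∀ {n} {Γ Γ' : TyCtx n} {m e t M M'} →
       Γ ⊩[ m , e ] t ∶ M → Γ ≈ Γ' → M ≅M M' → Γ' ⊩[ m , e ] t ∶ M'
conv (ax~ {x = x} ne p) q r    = ax~ (nonempty-resp r ne) (Ctx.trans (Ctx.sym q) (Ctx.trans p (single-cong x r)))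
conv (many~ ds p ne) q r       = many~ (ℓs-ctx ds q) (≅M-trans p r) (nonempty-resp r ne)
  where
    ℓs-ctx : ∀ {n} {Γ Γ' : TyCtx n} {m e t Ls} → Γ ⊩ℓs[ m , e ] t ∶ Ls → Γ ≈ Γ' → Γ' ⊩ℓs[ m , e ] t ∶ Ls
    ℓs-ctx (nil~ p)       q = nil~ (Ctx.trans (Ctx.sym q) p)
    ℓs-ctx (cons~ d ds p) q = cons~ d ds (Ctx.trans (Ctx.sym q) p)
conv (appgc~ d p r₀) q r       = appgc~ d (Ctx.trans (Ctx.sym q) p) (≅M-trans r₀ r)
conv (app~ d d' ne eq p r₀) q r = app~ d d' ne eq (Ctx.trans (Ctx.sym q) p) (≅M-trans r₀ r)
conv (esgc~ d p r₀) q r        = esgc~ d (Ctx.trans (Ctx.sym q) p) (≅M-trans r₀ r)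
conv (es~ d d' ne eq p r₀) q r = es~ d d' ne eq (Ctx.trans (Ctx.sym q) p) (≅M-trans r₀ r)

convΓ : ∀ {n} {Γ Γ' : TyCtx n} {m e t M} → Γ ⊩[ m , e ] t ∶ M → Γ ≈ Γ' → Γ' ⊩[ m , e ] t ∶ M
convΓ d q = conv d q ≅M-refl

convℓ : ∀ {n} {Γ : TyCtx n} {m e t L L'} → Γ ⊩ℓ[ m , e ] t ∶ L → L ≅L L' → Γ ⊩ℓ[ m , e ] t ∶ L'
convℓ (normal~ p)    normal = normal~ p
convℓ (fun~ d p r)   q      = fun~ d p (≅L-trans (≅L-sym q) r)

recount : ∀ {n} {Γ : TyCtx n} {m e m' e' t M} → m ≡ m' → e ≡ e' →
          Γ ⊩[ m , e ] t ∶ M → Γ ⊩[ m' , e' ] t ∶ M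
recount refl refl d = d

ℓs-perm : ∀ {n} {Γ : TyCtx n} {m e t Ls Ls'} → Γ ⊩ℓs[ m , e ] t ∶ Ls → Ls ≅M Ls' →
          Γ ⊩ℓs[ m , e ] t ∶ Ls'
ℓs-perm d (Perm.refl q)               = pointwise d q
  where
    pointwise : ∀ {n} {Γ : TyCtx n} {m e t Ls Ls'} → Γ ⊩ℓs[ m , e ] t ∶ Ls →
                Pointwise _≅L_ Ls Ls' → Γ ⊩ℓs[ m , e ] t ∶ Ls'
    pointwise (nil~ p)       []      = nil~ p
    pointwise (cons~ d ds p) (q ∷ r) = cons~ (convℓ d q) (pointwise ds r) p
ℓs-perm (cons~ d ds p) (Perm.prep q r) = cons~ (convℓ d q) (ℓs-perm ds r) p
ℓs-perm (cons~ {Γ₁ = Γ₁} {m = m} {e = e} d (cons~ {Γ₁ = Γ₂} {Γ₃} {m₂} {e₂} {m₃} {e₃} d' ds p') p)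
        (Perm.swap q q' r) =
  recountℓs (x∙yz≈y∙xz m₂ m m₃) (x∙yz≈y∙xz e₂ e e₃)
    (cons~ (convℓ d' q') (cons~ (convℓ d q) (ℓs-perm ds r) Ctx.refl)
      (Ctx.trans p (Ctx.trans (Ctx.∙-congˡ p') (Ctx.x∙yz≈y∙xz Γ₁ Γ₂ Γ₃))))
  where
    recountℓs : ∀ {n} {Γ : TyCtx n} {m e m' e' t Ls} → m ≡ m' → e ≡ e' →
                Γ ⊩ℓs[ m , e ] t ∶ Ls → Γ ⊩ℓs[ m' , e' ] t ∶ Ls
    recountℓs refl refl d = d
ℓs-perm d (Perm.trans q r)             = ℓs-perm (ℓs-perm d q) r

mutual
  embed : ∀ {n} {Γ : TyCtx n} {m e t M} → Γ ⊢[ m , e ] t ∶ M → Γ ⊩[ m , e ] t ∶ M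
  embed (ax ne)         = ax~ ne Ctx.refl
  embed (many ne ds)    = many~ (embedℓs ds) ≅M-refl ne
  embed (appgc {m = m} d) =
    recount (+-comm 1 m) refl (appgc~ (embed d) Ctx.refl ≅M-refl)
  embed (app {m = m} {m' = m'} d d' ne eq) =
    recount (+-comm 1 (m + m')) refl (app~ (embed d) (embed d') ne eq Ctx.refl ≅M-refl)
  embed (esgc d)        = esgc~ (embed d) Ctx.refl ≅M-refl
  embed (es d d' ne eq) = es~ (embed d) (embed d') ne eq Ctx.refl ≅M-refl

  embedℓ : ∀ {n} {Γ : TyCtx n} {m e t L} → Γ ⊢ℓ[ m , e ] t ∶ L → Γ ⊩ℓ[ m , e ] t ∶ L
  embedℓ normal  = normal~ Ctx.refl
  embedℓ (fun d) = fun~ (embed d) Ctx.refl ≅L-refl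

  embedℓs : ∀ {n} {Γ : TyCtx n} {m e t Ls} → Γ ⊢ℓs[ m , e ] t ∶ Ls → Γ ⊩ℓs[ m , e ] t ∶ Ls
  embedℓs []       = nil~ Ctx.refl
  embedℓs (d ∷ ds) = cons~ (embedℓ d) (embedℓs ds) Ctx.refl

lift-ext : ∀ {n k} {f g : Fin n → Fin k} → f ≗ g → lift f ≗ lift g
lift-ext p zero    = refl
lift-ext p (suc x) = cong suc (p x)

ren-ext : ∀ {n k} {f g : Fin n → Fin k} → f ≗ g → ∀ t → ren f t ≡ ren g t
ren-ext p (var x)   = cong var (p x)
ren-ext p (lam t)   = cong lam (ren-ext (lift-ext p) t)
ren-ext p (app t s) = cong₂ app (ren-ext p t) (ren-ext p s)
ren-ext p (es t s)  = cong₂ es (ren-ext (lift-ext p) t) (ren-ext p s)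

lift-∘ : ∀ {n k l} (f : Fin k → Fin l) (g : Fin n → Fin k) → (lift f ∘ lift g) ≗ lift (f ∘ g)
lift-∘ f g zero    = refl
lift-∘ f g (suc x) = refl

ren-∘ : ∀ {n k l} (f : Fin k → Fin l) (g : Fin n → Fin k) t → ren f (ren g t) ≡ ren (f ∘ g) t
ren-∘ f g (var x)   = refl
ren-∘ f g (lam t)   = cong lam (trans (ren-∘ (lift f) (lift g) t) (ren-ext (lift-∘ f g) t))
ren-∘ f g (app t s) = cong₂ app (ren-∘ f g t) (ren-∘ f g s)
ren-∘ f g (es t s)  = cong₂ es (trans (ren-∘ (lift f) (lift g) t) (ren-ext (lift-∘ f g) t)) (ren-∘ f g s)

lift-id : ∀ {n} → lift (id {A = Fin n}) ≗ id
lift-id zero    = refl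
lift-id (suc x) = refl

ren-id : ∀ {n} (t : Tm n) → ren id t ≡ t
ren-id (var x)   = refl
ren-id (lam t)   = cong lam (trans (ren-ext lift-id t) (ren-id t))
ren-id (app t s) = cong₂ app (ren-id t) (ren-id s)
ren-id (es t s)  = cong₂ es (trans (ren-ext lift-id t) (ren-id t)) (ren-id s)

-- Thinnings: order-preserving embeddings of scopes.  Along a thinning a
-- type context can be transported (fresh variables get the type 0), which
-- is what makes typing stable under weakening.
data Th : ℕ → ℕ → Set where
  done : ∀ {n} → Th n n
  keep : ∀ {n k} → Th n k → Th (suc n) (suc k)
  skip : ∀ {n k} → Th (suc n) k → Th n k

⟦_⟧ : ∀ {n k} → Th n k → Fin n → Fin k
⟦ done ⟧   = id
⟦ keep ρ ⟧ = lift ⟦ ρ ⟧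
⟦ skip ρ ⟧ = ⟦ ρ ⟧ ∘ suc

thC : ∀ {n k} → Th n k → TyCtx n → TyCtx k
thC done     Γ       = Γ
thC (keep ρ) (M ∷ Γ) = M ∷ thC ρ Γ
thC (skip ρ) Γ       = thC ρ ([] ∷ Γ)

thC-⊎ : ∀ {n k} (ρ : Th n k) (Γ Δ : TyCtx n) → thC ρ (Γ ⊎ Δ) ≡ thC ρ Γ ⊎ thC ρ Δ
thC-⊎ done     Γ       Δ       = refl
thC-⊎ (keep ρ) (M ∷ Γ) (N ∷ Δ) = cong ((M ++ N) ∷_) (thC-⊎ ρ Γ Δ)
thC-⊎ (skip ρ) Γ       Δ       = thC-⊎ ρ ([] ∷ Γ) ([] ∷ Δ)

thC-∅ : ∀ {n k} (ρ : Th n k) → thC ρ ∅ ≡ ∅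
thC-∅ done     = refl
thC-∅ (keep ρ) = cong ([] ∷_) (thC-∅ ρ)
thC-∅ (skip ρ) = thC-∅ ρ

thC-single : ∀ {n k} (ρ : Th n k) x M → thC ρ (single x M) ≡ single (⟦ ρ ⟧ x) M
thC-single done     x       M = refl
thC-single (keep ρ) zero    M = cong (M ∷_) (thC-∅ ρ)
thC-single (keep ρ) (suc x) M = cong ([] ∷_) (thC-single ρ x M)
thC-single (skip ρ) x       M = thC-single ρ (suc x) M

thC-cong : ∀ {n k} (ρ : Th n k) {Γ Γ' : TyCtx n} → Γ ≈ Γ' → thC ρ Γ ≈ thC ρ Γ'
thC-cong done     p       = p
thC-cong (keep ρ) (q ∷ p) = q ∷ thC-cong ρ p
thC-cong (skip ρ) p       = thC-cong ρ (≅M-refl ∷ p)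

thC-split : ∀ {n k} (ρ : Th n k) {Γ Γ₁ Γ₂ : TyCtx n} → Γ ≈ Γ₁ ⊎ Γ₂ → thC ρ Γ ≈ thC ρ Γ₁ ⊎ thC ρ Γ₂
thC-split ρ {Γ₁ = Γ₁} {Γ₂} p = Ctx.trans (thC-cong ρ p) (Ctx.reflexive (thC-⊎ ρ Γ₁ Γ₂))

thC-empty : ∀ {n k} (ρ : Th n k) {Γ : TyCtx n} → Γ ≈ ∅ → thC ρ Γ ≈ ∅
thC-empty ρ p = Ctx.trans (thC-cong ρ p) (Ctx.reflexive (thC-∅ ρ))

mutual
  weaken : ∀ {n k} (ρ : Th n k) {Γ : TyCtx n} {m e t M} →
           Γ ⊩[ m , e ] t ∶ M → thC ρ Γ ⊩[ m , e ] ren ⟦ ρ ⟧ t ∶ M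
  weaken ρ (ax~ {x = x} {M} ne p) =
    ax~ ne (Ctx.trans (thC-cong ρ p) (Ctx.reflexive (thC-single ρ x M)))
  weaken ρ (many~ ds p ne)         = many~ (weakenℓs ρ ds) p ne
  weaken ρ (appgc~ d p r)          = appgc~ (weaken ρ d) (thC-cong ρ p) r
  weaken ρ (app~ d d' ne eq p r)   = app~ (weaken ρ d) (weaken ρ d') ne eq (thC-split ρ p) r
  weaken ρ (esgc~ d p r)           = esgc~ (weaken (keep ρ) d) (thC-cong ρ p) r
  weaken ρ (es~ d d' ne eq p r)    = es~ (weaken (keep ρ) d) (weaken ρ d') ne eq (thC-split ρ p) r

  weakenℓ : ∀ {n k} (ρ : Th n k) {Γ : TyCtx n} {m e t L} →
            Γ ⊩ℓ[ m , e ] t ∶ L → thC ρ Γ ⊩ℓ[ m , e ] ren ⟦ ρ ⟧ t ∶ L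
  weakenℓ ρ (normal~ p)  = normal~ (thC-empty ρ p)
  weakenℓ ρ (fun~ d p r) = fun~ (weaken (keep ρ) d) (thC-cong ρ p) r

  weakenℓs : ∀ {n k} (ρ : Th n k) {Γ : TyCtx n} {m e t Ls} →
             Γ ⊩ℓs[ m , e ] t ∶ Ls → thC ρ Γ ⊩ℓs[ m , e ] ren ⟦ ρ ⟧ t ∶ Ls
  weakenℓs ρ (nil~ p)       = nil~ (thC-empty ρ p)
  weakenℓs ρ (cons~ d ds p) = cons~ (weakenℓ ρ d) (weakenℓs ρ ds) (thC-split ρ p)

sTh : ∀ {n} (S : SCtx n) → Th n (hsS S)
sTh hole      = done
sTh (sES S t) = skip (sTh S)

sTh-sWk : ∀ {n} (S : SCtx n) → ⟦ sTh S ⟧ ≡ sWk S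
sTh-sWk hole      = refl
sTh-sWk (sES S t) = cong (_∘ suc) (sTh-sWk S)

-- A derivation of S⟨u⟩ splits into a derivation of u (in the scope of the
-- hole) and the derivations of the substituted terms of S.  The latter can
-- be reused to type S⟨w⟩ for any w typed with the same type, whose context
-- may contain an extra part Ξ coming from outside S.
record UnplugS {n} (S : SCtx n) (Π : TyCtx n) (m e : ℕ) (u : Tm (hsS S)) (M : Multi) : Set where
  constructor unplugS
  field
    Δ               : TyCtx (hsS S)
    m-in e-in       : ℕ
    m-out e-out     : ℕ
    m-sum           : m ≡ m-out + m-in
    e-sum           : e ≡ e-out + e-in
    inner           : Δ ⊩[ m-in , e-in ] u ∶ M
    replug          : ∀ {w Ξ Δ' mw ew M'} → Δ' ⊩[ mw , ew ] w ∶ M' → Δ' ≈ Δ ⊎ thC (sTh S) Ξ →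
                      (Π ⊎ Ξ) ⊩[ m-out + mw , e-out + ew ] plugS S w ∶ M'

unplugS-derivation : ∀ {n} (S : SCtx n) {Π m e u M} → Π ⊩[ m , e ] plugS S u ∶ M → UnplugS S Π m e u M
unplugS-derivation hole {m = m} {e} d = unplugS _ m e 0 0 refl refl d convΓ
unplugS-derivation (sES S t) (esgc~ d p r) with unplugS-derivation S d
... | unplugS Δ m₁ e₁ m₂ e₂ refl refl du rb =
  unplugS Δ m₁ e₁ m₂ e₂ refl refl (conv du Ctx.refl r)
    (λ dw q → esgc~ (rb dw q) (Ctx.∙-congʳ p) ≅M-refl)
unplugS-derivation (sES S t) (es~ {Γ₁ = Γ₁} {Γ₂} {m' = m'} {e' = e'} {N = N} d d' ne eq p r)
  with unplugS-derivation S d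
... | unplugS Δ m₁ e₁ m₂ e₂ refl refl du rb =
  unplugS Δ m₁ e₁ (m₂ + m') (e₂ + e') (xy∙z≈xz∙y m₂ m₁ m') (xy∙z≈xz∙y e₂ e₁ e')
    (conv du Ctx.refl r)
    (λ {w} {Ξ} {mw = mw} {ew} dw q →
      recount (xy∙z≈xz∙y m₂ mw m') (xy∙z≈xz∙y e₂ ew e')
        (es~ (convΓ (rb dw q) (Multiset.++-identityʳ N ∷ Ctx.refl)) d' ne eq
          (Ctx.trans (Ctx.∙-congʳ p) (Ctx.xy∙z≈xz∙y Γ₁ Γ₂ Ξ)) ≅M-refl))

-- In a derivation of E⟨⟨x⟩⟩ the variable x is typed
-- by an axiom with some non-empty K, using one exponential step.  Filling
-- the hole with any term of type K instead (possibly after thinning the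
-- scope) yields a derivation with the counters adjusted accordingly.
Replace : ∀ {n} (E : ECtx n) (ΓE : TyCtx n) (m eE : ℕ) (K M : Multi) → Set
Replace {n} E ΓE m eE K M =
  ∀ {k} (ρ : Th n k) {Θ mu eu u} → Θ ⊩[ mu , eu ] u ∶ K →
  (thC ρ ΓE ⊎ Θ) ⊩[ m + mu , eE + eu ] plugE⟪ renE ⟦ ρ ⟧ E ⟫ u ∶ M

record UnplugE {n} (E : ECtx n) (x : Fin n) (Γ : TyCtx n) (m e : ℕ) (M : Multi) : Set where
  constructor unplugE
  field
    K         : Multi
    K≢0       : K ≢ []
    ΓE        : TyCtx n
    eE        : ℕ
    e-suc     : e ≡ suc eE
    split     : Γ ≈ ΓE ⊎ single x K
    replace   : Replace E ΓE m eE K M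

head-nonempty : ∀ {n} {E : ECtx (suc n)} {N Γ m e M} → UnplugE E zero (N ∷ Γ) m e M → N ≢ []
head-nonempty (unplugE K K≢0 (A ∷ _) _ _ (q ∷ _) _) refl =
  K≢0 (List.++-conicalʳ A K (≅0⇒≡0 (≅M-sym q)))

replace-hole : ∀ {n} (M : Multi) → Replace {n} hole ∅ 0 0 M M
replace-hole M ρ {Θ} {u = u} du =
  subst (λ z → (thC ρ ∅ ⊎ Θ) ⊩[ _ , _ ] z ∶ M) (sym (ren-id u))
    (convΓ du (Ctx.sym (Ctx.trans (Ctx.∙-congʳ (Ctx.reflexive (thC-∅ ρ))) (Ctx.identityˡ Θ))))

replace-under : ∀ {n} {E : ECtx (suc n)} {A N Γ m eE K M} → Replace E (A ∷ Γ) m eE K M →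
                N ≅M (A ++ []) → ∀ {k} (ρ : Th n k) {Θ mu eu u} → Θ ⊩[ mu , eu ] u ∶ K →
                (N ∷ (thC ρ Γ ⊎ Θ)) ⊩[ m + mu , eE + eu ]
                  plugE (renE (lift ⟦ ρ ⟧) E) (ren (eWk (renE (lift ⟦ ρ ⟧) E) ∘ suc) u) ∶ M
replace-under {E = E} rp q ρ {u = u} du =
  subst (λ z → _ ⊩[ _ , _ ] plugE (renE (lift ⟦ ρ ⟧) E) z ∶ _) (ren-∘ _ suc u)
    (convΓ (rp (keep ρ) (weaken (skip done) du)) (≅M-sym q ∷ Ctx.refl))

split-left : ∀ {n} {Γ Γ₁ Γ₂ A B : TyCtx n} → Γ ≈ Γ₁ ⊎ Γ₂ → Γ₁ ≈ A ⊎ B → Γ ≈ (A ⊎ Γ₂) ⊎ B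
split-left {Γ₂ = Γ₂} {A} {B} p q =
  Ctx.trans p (Ctx.trans (Ctx.∙-congʳ q) (Ctx.xy∙z≈xz∙y A B Γ₂))

thC-left : ∀ {n k} (ρ : Th n k) (A Γ₂ : TyCtx n) (Θ : TyCtx k) →
           (thC ρ (A ⊎ Γ₂) ⊎ Θ) ≈ (thC ρ A ⊎ Θ) ⊎ thC ρ Γ₂
thC-left ρ A Γ₂ Θ =
  Ctx.trans (Ctx.∙-congʳ (Ctx.reflexive (thC-⊎ ρ A Γ₂))) (Ctx.xy∙z≈xz∙y (thC ρ A) (thC ρ Γ₂) Θ)

mutual
  unplugE-derivation : ∀ {n} (E : ECtx n) x {Γ m e M} →
                       Γ ⊩[ m , e ] plugE⟪ E ⟫ (var x) ∶ M → UnplugE E x Γ m e M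
  unplugE-derivation hole x (ax~ {M = M} ne p) =
    unplugE M ne ∅ 0 refl (Ctx.trans p (Ctx.sym (Ctx.identityˡ _))) (replace-hole M)
  unplugE-derivation (appL E t) x (appgc~ d p r) with unplugE-derivation E x d
  ... | unplugE K ne ΓE eE e-suc sp rp =
    unplugE K ne ΓE eE e-suc (Ctx.trans p sp) (λ ρ du → appgc~ (rp ρ du) Ctx.refl r)
  unplugE-derivation (appL E t) x (app~ {Γ₂ = Γ₂} {m} {m' = m'} {e' = e'} d d' ne' eq p r)
    with unplugE-derivation E x d
  ... | unplugE K ne ΓE eE refl sp rp =
    unplugE K ne (ΓE ⊎ Γ₂) (eE + e') refl (split-left p sp)
      (λ ρ {Θ} {mu} {eu} du → recount (cong suc (xy∙z≈xz∙y m mu m')) (xy∙z≈xz∙y eE eu e')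
        (app~ (rp ρ du) (weaken ρ d') ne' eq (thC-left ρ ΓE Γ₂ Θ) r))
  unplugE-derivation (esL E t) x (esgc~ d p r) with unplugE-derivation E (suc x) d
  ... | unplugE K ne (A ∷ Γ') eE e-suc (q ∷ sp) rp =
    unplugE K ne Γ' eE e-suc (Ctx.trans p sp)
      (λ ρ du → esgc~ (replace-under rp q ρ du) Ctx.refl r)
  unplugE-derivation (esL E t) x (es~ {Γ₂ = Γ₂} {m} {m' = m'} {e' = e'} d d' ne' eq p r)
    with unplugE-derivation E (suc x) d
  ... | unplugE K ne (A ∷ Γ') eE refl (q ∷ sp) rp =
    unplugE K ne (Γ' ⊎ Γ₂) (eE + e') refl (split-left p sp)
      (λ ρ {Θ} {mu} {eu} du → recount (xy∙z≈xz∙y m mu m') (xy∙z≈xz∙y eE eu e')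
        (es~ (replace-under rp q ρ du) (weaken ρ d') ne' eq (thC-left ρ Γ' Γ₂ Θ) r))
  unplugE-derivation (esR E E') x (esgc~ d p r) =
    ⊥-elim (head-nonempty (unplugE-derivation E zero d) refl)
  unplugE-derivation (esR E E') x (es~ {Γ₁ = Γ₁} {m = m₁} {e = e₁} d d' ne' eq p r)
    with unplugE-derivation E' x d'
  ... | unplugE K ne ΓE eE refl sp rp =
    unplugE K ne (Γ₁ ⊎ ΓE) (e₁ + eE) (+-suc e₁ eE)
      (Ctx.trans p (Ctx.trans (Ctx.∙-congˡ sp) (Ctx.sym (Ctx.assoc Γ₁ ΓE _))))
      (λ ρ {Θ} {mu} {eu} du → recount (sym (+-assoc m₁ _ mu)) (sym (+-assoc e₁ eE eu))
        (es~ (weaken-plug E zero (keep ρ) d) (rp ρ du) ne' eq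
          (Ctx.trans (Ctx.∙-congʳ (Ctx.reflexive (thC-⊎ ρ Γ₁ ΓE))) (Ctx.assoc (thC ρ Γ₁) _ Θ)) r))

  weaken-plug : ∀ {n k} (E : ECtx n) x (ρ : Th n k) {Γ m e M} → Γ ⊩[ m , e ] plugE⟪ E ⟫ (var x) ∶ M →
                thC ρ Γ ⊩[ m , e ] plugE⟪ renE ⟦ ρ ⟧ E ⟫ (var (⟦ ρ ⟧ x)) ∶ M
  weaken-plug E x ρ {m = m} d with unplugE-derivation E x d
  ... | unplugE K ne ΓE eE refl sp rp =
    recount (+-identityʳ m) (+-comm eE 1)
      (convΓ (rp ρ (ax~ ne Ctx.refl))
        (Ctx.sym (Ctx.trans (thC-split ρ sp) (Ctx.∙-congˡ (Ctx.reflexive (thC-single ρ x K))))))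

record ArrowInv {n} (Δ : TyCtx n) (m e : ℕ) (b : Tm (suc n)) (N M : Multi) : Set where
  constructor arrowInv
  field
    {N₀ M₀} : Multi
    {Δ₀}    : TyCtx n
    body    : (N₀ ∷ Δ₀) ⊩[ m , e ] b ∶ M₀
    ctx≈    : Δ ≈ Δ₀
    dom≅    : N₀ ≅M N
    cod≅    : M₀ ≅M M

arrow-inv : ∀ {n} {Δ : TyCtx n} {m e b N M} → Δ ⊩[ m , e ] lam b ∶ ((N ⟶ M) ∷ []) → ArrowInv Δ m e b N M
arrow-inv (many~ (nil~ _) p _) with Multiset.xs↭ys⇒|xs|≡|ys| p
... | ()
arrow-inv (many~ (cons~ _ (cons~ _ _ _) _) p _) with Multiset.xs↭ys⇒|xs|≡|ys| p
... | ()
arrow-inv (many~ (cons~ (normal~ _) (nil~ _) _) p _) with singleton-inv p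
... | ()
arrow-inv (many~ (cons~ {m = m} {e = e} (fun~ body pf r) (nil~ q) pc) p _)
  with ≅L-trans (≅L-sym r) (singleton-inv p)
... | arr dom cod =
  arrowInv (recount (sym (+-identityʳ m)) (sym (+-identityʳ e)) body)
    (Ctx.trans pc (Ctx.trans (Ctx.∙-cong pf q) (Ctx.identityʳ _))) dom cod

-- Subject reduction for a multiplicative root step S⟨λx.b⟩ s ↦m S⟨b[x←s]⟩:
-- the application rule disappears, its premises are reassembled into an
-- explicit substitution inside S.
subject-m : ∀ {n} (S : SCtx n) b s {Γ₁ Γ₂ : TyCtx n} {mF eF ms es' N N' M₀} →
            Γ₁ ⊩[ mF , eF ] plugS S (lam b) ∶ ((N ⟶ M₀) ∷ []) → Γ₂ ⊩[ ms , es' ] s ∶ N' →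
            N ≢ [] → N ≅M N' →
            (Γ₁ ⊎ Γ₂) ⊩[ mF + ms , eF + es' ] plugS S (es b (ren (sWk S) s)) ∶ M₀
subject-m S b s {Γ₂ = Γ₂} {ms = ms} {es'} {N' = N'} dF ds ne eq with unplugS-derivation S dF
... | unplugS Δ m₁ e₁ m₂ e₂ refl refl du rb with arrow-inv du
... | arrowInv body cx dom cod =
  recount (sym (+-assoc m₂ m₁ ms)) (sym (+-assoc e₂ e₁ es'))
    (rb (es~ body ds' (nonempty-resp (≅M-sym dom) ne) (≅M-trans dom eq) Ctx.refl cod)
        (Ctx.∙-congʳ (Ctx.sym cx)))
  where
    ds' : thC (sTh S) Γ₂ ⊩[ ms , es' ] ren (sWk S) s ∶ N'
    ds' = subst (λ f → thC (sTh S) Γ₂ ⊩[ ms , es' ] ren f s ∶ N') (sTh-sWk S) (weaken (sTh S) ds)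

subject-m-gc : ∀ {n} (S : SCtx n) b s {Γ : TyCtx n} {mF eF M₀} →
               Γ ⊩[ mF , eF ] plugS S (lam b) ∶ (([] ⟶ M₀) ∷ []) →
               Γ ⊩[ mF , eF ] plugS S (es b (ren (sWk S) s)) ∶ M₀
subject-m-gc S b s {Γ} dF with unplugS-derivation S dF
... | unplugS Δ m₁ e₁ m₂ e₂ refl refl du rb with arrow-inv du
... | arrowInv body cx dom cod with ≅0⇒≡0 dom
... | refl =
  convΓ (rb {Ξ = ∅} (esgc~ body Ctx.refl cod)
          (Ctx.trans (Ctx.sym cx) (Ctx.sym (Ctx.trans (Ctx.∙-congˡ (Ctx.reflexive (thC-∅ (sTh S)))) (Ctx.identityʳ Δ)))))
        (Ctx.identityʳ Γ)

record FamilySplit {n} (Γ : TyCtx n) (m e : ℕ) (t : Tm n) (A B : List Lin) : Set where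
  constructor familySplit
  field
    Γ₁ Γ₂       : TyCtx n
    m₁ e₁ m₂ e₂ : ℕ
    dA          : Γ₁ ⊩ℓs[ m₁ , e₁ ] t ∶ A
    dB          : Γ₂ ⊩ℓs[ m₂ , e₂ ] t ∶ B
    ctx-sum     : Γ ≈ Γ₁ ⊎ Γ₂
    m-sum       : m ≡ m₁ + m₂
    e-sum       : e ≡ e₁ + e₂

split-family : ∀ {n} {Γ : TyCtx n} {m e t} A B → Γ ⊩ℓs[ m , e ] t ∶ (A ++ B) → FamilySplit Γ m e t A B
split-family {Γ = Γ} {m} {e} [] B d = familySplit ∅ Γ 0 0 m e (nil~ Ctx.refl) d (Ctx.sym (Ctx.identityˡ Γ)) refl refl
split-family (a ∷ A) B (cons~ {Γ₁ = Γa} {m = ma} {e = ea} d ds p) with split-family A B ds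
... | familySplit Γ₁ Γ₂ m₁ e₁ m₂ e₂ dA dB cx refl refl =
  familySplit (Γa ⊎ Γ₁) Γ₂ (ma + m₁) (ea + e₁) m₂ e₂ (cons~ d dA Ctx.refl) dB
    (Ctx.trans p (Ctx.trans (Ctx.∙-congˡ cx) (Ctx.sym (Ctx.assoc Γa Γ₁ Γ₂))))
    (sym (+-assoc ma m₁ m₂)) (sym (+-assoc ea e₁ e₂))

es-value : ∀ {n} (N : Multi) {Ξ Δ : TyCtx n} {mX eX mv ev X b M} →
           (N ∷ Ξ) ⊩[ mX , eX ] X ∶ M → Δ ⊩ℓs[ mv , ev ] lam b ∶ N →
           (Ξ ⊎ Δ) ⊩[ mX + mv , eX + ev ] es X (lam b) ∶ M
es-value [] {Ξ} {mX = mX} {eX} dX (nil~ q) =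
  recount (sym (+-identityʳ mX)) (sym (+-identityʳ eX))
    (esgc~ dX (Ctx.trans (Ctx.∙-congˡ q) (Ctx.identityʳ Ξ)) ≅M-refl)
es-value (_ ∷ _) dX dv = es~ dX (many~ dv ≅M-refl (λ ())) (λ ()) ≅M-refl Ctx.refl ≅M-refl

-- The heart of an exponential step E⟨⟨x⟩⟩[x←v] with v = λb: the copies of
-- v typed by the multiset Nr ++ K given to x are distributed between the
-- hole of E (K, replacing the consumed axiom) and the remaining
-- occurrences of x (Nr), which stay bound by the new substitution [x←v].
duplicate-value : ∀ {n k} {E : ECtx (suc n)} {Nr ΓE m eE K M} (ρ : Th n k) {Δ : TyCtx k} {mv ev b} →
                  Replace E (Nr ∷ ΓE) m eE K M → K ≢ [] → Δ ⊩ℓs[ mv , ev ] lam b ∶ (Nr ++ K) →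
                  (thC ρ ΓE ⊎ Δ) ⊩[ m + mv , eE + ev ]
                    es (plugE⟪ renE (lift ⟦ ρ ⟧) E ⟫ (ren suc (lam b))) (lam b) ∶ M
duplicate-value {Nr = Nr} {ΓE} {m} {eE} {K} ρ rp K≢0 dv with split-family Nr K dv
... | familySplit Δr ΔK mr er mK eK dr dK cx refl refl =
  recount (xy∙z≈x∙zy m mK mr) (xy∙z≈x∙zy eE eK er)
    (convΓ (es-value Nr hole-filled dr)
      (Ctx.trans (Ctx.xy∙z≈x∙zy (thC ρ ΓE) ΔK Δr) (Ctx.∙-congˡ (Ctx.sym cx))))
  where
    hole-filled = convΓ (rp (keep ρ) (weaken (skip done) (many~ dK ≅M-refl K≢0)))
                        (Multiset.++-identityʳ Nr ∷ Ctx.refl)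

-- Subject reduction for an exponential root step
-- E⟨⟨x⟩⟩[x←S⟨v⟩] ↦e S⟨E⟨⟨v⟩⟩[x←v]⟩: exactly one exponential step (the
-- axiom typing the occurrence of x in the hole of E) is consumed.
subject-e : ∀ {n} (E : ECtx (suc n)) (S : SCtx n) b {Γ Γ₁ Γ₂ : TyCtx n} {m e m' e' M₀ M N N'} →
            (N ∷ Γ₁) ⊩[ m , e ] plugE⟪ E ⟫ (var zero) ∶ M₀ → Γ₂ ⊩[ m' , e' ] plugS S (lam b) ∶ N' →
            N ≅M N' → Γ ≈ Γ₁ ⊎ Γ₂ → M₀ ≅M M →
            Σ ℕ λ e'' → (e + e' ≡ suc e'') ×
              Γ ⊩[ m + m' , e'' ] plugS S (es (plugE⟪ renE (lift (sWk S)) E ⟫ (ren suc (lam b))) (lam b)) ∶ M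
subject-e E S b {Γ} {Γ₁} {Γ₂} {m} {M₀ = M₀} d₁ d₂ eq cx r
  with unplugE-derivation E zero d₁ | unplugS-derivation S d₂
... | unplugE K K≢0 (Nr ∷ ΓE) eE refl (q ∷ sp) rp | unplugS Δ m₁ e₁ m₂ e₂ refl refl (many~ ds p _) rb =
  e₂ + (eE + e₁) , cong suc (x∙yz≈y∙xz eE e₂ e₁) ,
  recount (x∙yz≈y∙xz m₂ m m₁) refl (conv (rb body (Ctx.comm _ Δ)) ctx≈ r)
  where
    dv : Δ ⊩ℓs[ m₁ , e₁ ] lam b ∶ (Nr ++ K)
    dv = ℓs-perm ds (≅M-trans p (≅M-trans (≅M-sym eq) q))
    body : (thC (sTh S) ΓE ⊎ Δ) ⊩[ m + m₁ , eE + e₁ ]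
             es (plugE⟪ renE (lift (sWk S)) E ⟫ (ren suc (lam b))) (lam b) ∶ M₀
    body = subst (λ f → (thC (sTh S) ΓE ⊎ Δ) ⊩[ m + m₁ , eE + e₁ ]
                          es (plugE⟪ renE (lift f) E ⟫ (ren suc (lam b))) (lam b) ∶ M₀)
                 (sTh-sWk S) (duplicate-value (sTh S) rp K≢0 dv)
    ctx≈ : (Γ₂ ⊎ ΓE) ≈ Γ
    ctx≈ = Ctx.sym (Ctx.trans cx (Ctx.trans (Ctx.∙-congʳ (Ctx.trans sp (Ctx.identityʳ ΓE))) (Ctx.comm ΓE Γ₂)))

normal-shape : ∀ {n} {t : Tm n} → Normal t → Σ (SCtx n) λ S → Σ (Tm (suc (hsS S))) λ b → t ≡ plugS S (lam b)
normal-shape nlam = hole , _ , refl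
normal-shape (nes {s = s} nt) with normal-shape nt
... | S , b , refl = sES S s , b , refl

tight-normal : ∀ {n} {Γ : TyCtx n} {m e t M} → Normal t → Γ ⊩[ m , e ] t ∶ M → M ≅M (normal ∷ []) →
               (Γ ≈ ∅) × (m ≡ 0) × (e ≡ 0)
tight-normal nlam (many~ (nil~ _) p _) r with Multiset.xs↭ys⇒|xs|≡|ys| (≅M-trans p r)
... | ()
tight-normal nlam (many~ (cons~ _ (cons~ _ _ _) _) p _) r with Multiset.xs↭ys⇒|xs|≡|ys| (≅M-trans p r)
... | ()
tight-normal nlam (many~ (cons~ (normal~ q) (nil~ q') pc) _ _) _ =
  Ctx.trans pc (Ctx.trans (Ctx.∙-cong q q') (Ctx.identityˡ ∅)) , refl , refl
tight-normal nlam (many~ (cons~ (fun~ _ _ r') (nil~ _) _) p _) r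
  with ≅L-trans (≅L-sym r') (singleton-inv (≅M-trans p r))
... | ()
tight-normal (nes nt) (esgc~ d p r) r' with tight-normal nt d (≅M-trans r r')
... | (_ ∷ q) , refl , refl = Ctx.trans p q , refl , refl
tight-normal (nes nt) (es~ d _ ne _ _ r) r' with tight-normal nt d (≅M-trans r r')
... | (q ∷ _) , _ = ⊥-elim (ne (≅0⇒≡0 q))

data Progress {n} (Γ : TyCtx n) (t : Tm n) (m e : ℕ) (M : Multi) : Set where
  is-normal : Normal t → Progress Γ t m e M
  stuck     : (E : ECtx n) (x : Fin n) → t ≡ plugE⟪ E ⟫ (var x) → Progress Γ t m e M
  step-m    : ∀ {t' m'} → Step mul t t' → m ≡ suc m' → Γ ⊩[ m' , e ] t' ∶ M → Progress Γ t m e M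
  step-e    : ∀ {t' e'} → Step expo t t' → e ≡ suc e' → Γ ⊩[ m , e' ] t' ∶ M → Progress Γ t m e M

step-appL : ∀ {n k} {t t' : Tm n} s → Step k t t' → Step k (app t s) (app t' s)
step-appL s (ctx E r) = ctx (appL E s) r

step-esL : ∀ {n k} {t t' : Tm (suc n)} s → Step k t t' → Step k (es t s) (es t' s)
step-esL s (ctx E r) = ctx (esL E s) r

step-esR : ∀ {n k} (E : ECtx (suc n)) {s s' : Tm n} → Step k s s' →
           Step k (es (plugE⟪ E ⟫ (var zero)) s) (es (plugE⟪ E ⟫ (var zero)) s')
step-esR E (ctx E' r) = ctx (esR E E') r

progress-appgc : ∀ {n} {Γ Γ₀ : TyCtx n} {m e t s M₀ M} → Progress Γ₀ t m e (([] ⟶ M₀) ∷ []) →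
                 Γ₀ ⊩[ m , e ] t ∶ (([] ⟶ M₀) ∷ []) → Γ ≈ Γ₀ → M₀ ≅M M →
                 Progress Γ (app t s) (suc m) e M
progress-appgc {s = s} (is-normal nt) d p r with normal-shape nt
... | S , b , refl = step-m (ctx hole (↦m S b s)) refl (conv (subject-m-gc S b s d) (Ctx.sym p) r)
progress-appgc {s = s} (stuck E x refl) _ _ _ = stuck (appL E s) x refl
progress-appgc {s = s} (step-m st refl d') _ p r = step-m (step-appL s st) refl (appgc~ d' p r)
progress-appgc {s = s} (step-e st refl d') _ p r = step-e (step-appL s st) refl (appgc~ d' p r)

progress-app : ∀ {n} {Γ Γ₁ Γ₂ : TyCtx n} {m e m' e' t s M₀ M N N'} →
               Progress Γ₁ t m e ((N ⟶ M₀) ∷ []) →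
               Γ₁ ⊩[ m , e ] t ∶ ((N ⟶ M₀) ∷ []) → Γ₂ ⊩[ m' , e' ] s ∶ N' → N ≢ [] → N ≅M N' →
               Γ ≈ Γ₁ ⊎ Γ₂ → M₀ ≅M M → Progress Γ (app t s) (suc (m + m')) (e + e') M
progress-app {s = s} (is-normal nt) d d' ne eq p r with normal-shape nt
... | S , b , refl = step-m (ctx hole (↦m S b s)) refl (conv (subject-m S b s d d' ne eq) (Ctx.sym p) r)
progress-app {s = s} (stuck E x refl) _ _ _ _ _ _ = stuck (appL E s) x refl
progress-app {s = s} (step-m st refl d₀) _ d' ne eq p r = step-m (step-appL s st) refl (app~ d₀ d' ne eq p r)
progress-app {s = s} (step-e st refl d₀) _ d' ne eq p r = step-e (step-appL s st) refl (app~ d₀ d' ne eq p r)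

progress-esgc : ∀ {n} {Γ Γ₀ : TyCtx n} {m e t s M₀ M} → Progress ([] ∷ Γ₀) t m e M₀ →
                ([] ∷ Γ₀) ⊩[ m , e ] t ∶ M₀ → Γ ≈ Γ₀ → M₀ ≅M M → Progress Γ (es t s) m e M
progress-esgc (is-normal nt) _ _ _ = is-normal (nes nt)
progress-esgc {s = s} (stuck E (suc x) refl) _ _ _ = stuck (esL E s) x refl
progress-esgc (stuck E zero refl) d _ _ = ⊥-elim (head-nonempty (unplugE-derivation E zero d) refl)
progress-esgc {s = s} (step-m st refl d₀) _ p r = step-m (step-esL s st) refl (esgc~ d₀ p r)
progress-esgc {s = s} (step-e st refl d₀) _ p r = step-e (step-esL s st) refl (esgc~ d₀ p r)

progress-es : ∀ {n} {Γ Γ₁ Γ₂ : TyCtx n} {m e m' e' t s M₀ M N N'} →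
              Progress (N ∷ Γ₁) t m e M₀ → Progress Γ₂ s m' e' N' →
              (N ∷ Γ₁) ⊩[ m , e ] t ∶ M₀ → Γ₂ ⊩[ m' , e' ] s ∶ N' → N ≢ [] → N ≅M N' →
              Γ ≈ Γ₁ ⊎ Γ₂ → M₀ ≅M M → Progress Γ (es t s) (m + m') (e + e') M
progress-es (is-normal nt) _ _ _ _ _ _ _ = is-normal (nes nt)
progress-es {s = s} (stuck E (suc x) refl) _ _ _ _ _ _ _ = stuck (esL E s) x refl
progress-es {s = s} (step-m st refl d₀) _ _ d' ne eq p r = step-m (step-esL s st) refl (es~ d₀ d' ne eq p r)
progress-es {s = s} (step-e st refl d₀) _ _ d' ne eq p r = step-e (step-esL s st) refl (es~ d₀ d' ne eq p r)
progress-es (stuck E zero refl) (is-normal ns) d d' _ eq p r with normal-shape ns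
... | S , b , refl with subject-e E S b d d' eq p r
... | e'' , e-suc , d'' = step-e (ctx hole (↦e E S b)) e-suc d''
progress-es (stuck E zero refl) (stuck E' y refl) _ _ _ _ _ _ = stuck (esR E E') y refl
progress-es {m = m} (stuck E zero refl) (step-m {m' = m''} st refl d₀) d _ ne eq p r =
  step-m (step-esR E st) (+-suc m m'') (es~ d d₀ ne eq p r)
progress-es {e = e} (stuck E zero refl) (step-e {e' = e''} st refl d₀) d _ ne eq p r =
  step-e (step-esR E st) (+-suc e e'') (es~ d d₀ ne eq p r)

progress : ∀ {n} {Γ : TyCtx n} {m e t M} → Γ ⊩[ m , e ] t ∶ M → Progress Γ t m e M
progress (ax~ {x = x} _ _)      = stuck hole x refl
progress (many~ _ _ _)          = is-normal nlam
progress (appgc~ d p r)         = progress-appgc (progress d) d p r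
progress (app~ d d' ne eq p r)  = progress-app (progress d) d d' ne eq p r
progress (esgc~ d p r)          = progress-esgc (progress d) d p r
progress (es~ d d' ne eq p r)   = progress-es (progress d) (progress d') d d' ne eq p r

record Evaluation (t : Tm 0) (m e : ℕ) (M : Multi) : Set where
  constructor evaluation
  field
    s             : Tm 0
    d             : t ⇒* s
    normal-s      : Normal s
    m-rest e-rest : ℕ
    m-sum         : ∣ d ∣m + m-rest ≡ m
    e-sum         : ∣ d ∣e + e-rest ≡ e
    tight-exact   : M ≅M (normal ∷ []) → (m-rest ≡ 0) × (e-rest ≡ 0)

-- Typed closed terms evaluate to normal form.  A closed term is never stuck,
-- and each step decreases m, or keeps m and decreases e; so the recursion
-- is on the counters, lexicographically.
evaluate : ∀ {t : Tm 0} {m e M} → [] ⊩[ m , e ] t ∶ M → Evaluation t m e M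
evaluate {m = m} {e} D with progress D
... | is-normal nt = evaluation _ ε nt m e refl refl tight
  where
    tight : _ ≅M (normal ∷ []) → (m ≡ 0) × (e ≡ 0)
    tight r with tight-normal nt D r
    ... | _ , m≡0 , e≡0 = m≡0 , e≡0
... | stuck E () _
... | step-m st refl D' with evaluate D'
...   | evaluation s d ns mr er m-sum e-sum exact =
        evaluation s (st ◅ d) ns mr er (cong suc m-sum) e-sum exact
evaluate D | step-e st refl D' with evaluate D'
...   | evaluation s d ns mr er m-sum e-sum exact =
        evaluation s (st ◅ d) ns mr er m-sum (cong suc e-sum) exact

theorem5 : (t : Tm 0) {m e : ℕ} {M : Multi} (Φ : [] ⊢[ m , e ] t ∶ M) →
           Σ (Tm 0) λ s → Σ (t ⇒* s) λ d →
             Normal s × ∣ d ∣m ≤ m × ∣ d ∣e ≤ e ×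
             (Tight Φ → ∣ d ∣m ≡ m × ∣ d ∣e ≡ e)
theorem5 t {m} {e} Φ with evaluate (embed Φ)
... | evaluation s d ns m-rest e-rest m-sum e-sum exact =
  s , d , ns , bounded m-sum , bounded e-sum , tight-exact
  where
    bounded : ∀ {a b c} → a + b ≡ c → a ≤ c
    bounded {a} {b} refl = m≤m+n a b

    tight-exact : Tight Φ → ∣ d ∣m ≡ m × ∣ d ∣e ≡ e
    tight-exact (refl , _) with exact ≅M-refl
    ... | refl , refl = trans (sym (+-identityʳ _)) m-sum , trans (sym (+-identityʳ _)) e-sum
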